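{- Fix $0<c<1$ and a fixed integer $s\ge1$. For each $n$, let $\Gamma_n$ be a group of order $n$ and $h_n$ an integer with $h_n/n\ge c$, let $H_n$ be chosen uniformly at random among all $h_n$-element subsets of $\Gamma_n$, and let $G_n=\mathrm{Cay}(\Gamma_n,H_n)$. Then $\Pr\big(d_{s1}(G_n)\le 2\big)\to 1$ as $n\to\infty$.
   Context: The Cayley digraph $\mathrm{Cay}(\Gamma,H)$ has vertex set $\Gamma$ and an edge from $x$ to $y$ whenever $y=hx$ for some $h\in H$ (loops allowed). Activation process: given a digraph with vertex set $V$, a set $S\subseteq V$ and threshold $t$, put $S_0=S$ and $S_i=S_{i-1}\cup\{v\notin S_{i-1}: v \text{ has at least } t \text{ edges } (u,v) \text{ with } u\in S_{i-1}\}$ for $i\ge1$. $d(S,t)$ is the smallest $i$ with $S_i=V$ ($\infty$ if none exists), and $d_{st}(G)=\max\{d(S,t): S\subseteq V,\ |S|=s\}$; in particular $d_{11}$ is the ordinary diameter. -}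

module Defs where

open import Data.Nat using (ℕ; zero; suc; _≤ᵇ_)
open import Data.Bool using (Bool; _∨_)
open import Data.Fin using (Fin; toℕ)
open import Data.Fin.Subset using (Subset; _∈_; ⊤; ∣_∣; inside; outside)
open import Data.Fin.Subset.Properties using (_∈?_)
open import Data.Fin.Properties using (any?)
open import Data.Vec using (Vec; []; _∷_; tabulate; lookup)
import Data.Vec.Properties as VecP
import Data.Bool.Properties as BoolP
open import Data.List using (List; []; _∷_; map; _++_; filter; length; allFin)
open import Data.Product using (Σ; ∃; _×_; _,_)
open import Relation.Nullary using (Dec; ¬_)
open import Relation.Nullary.Decidable using (_×-dec_)
open import Relation.Unary using (Pred; Decidable)
open import Relation.Binary.PropositionalEquality using (_≡_)
open import Algebra.Structures using (IsGroup)
open import Level using (0ℓ)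

countFin : ∀ {n} {P : Pred (Fin n) 0ℓ} → Decidable P → ℕ
countFin {n} P? = length (filter P? (allFin n))

allSubsets : ∀ n → List (Subset n)
allSubsets zero = [] ∷ []
allSubsets (suc n) = map (inside ∷_) (allSubsets n) ++ map (outside ∷_) (allSubsets n)

countSubsets : ∀ {n} {P : Pred (Subset n) 0ℓ} → Decidable P → ℕ
countSubsets {n} P? = length (filter P? (allSubsets n))

-- A digraph on vertex set Fin n, with a decidable edge relation
-- (at most one edge between any ordered pair; loops allowed).
record Digraph (n : ℕ) : Set₁ where
  field
    Edge  : Fin n → Fin n → Set
    Edge? : ∀ u v → Dec (Edge u v)

module _ {n : ℕ} (G : Digraph n) where
  open Digraph G

  inCount : Subset n → Fin n → ℕ
  inCount S v = countFin (λ u → (u ∈? S) ×-dec Edge? u v)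

  step : ℕ → Subset n → Subset n
  step t S = tabulate (λ v → lookup S v ∨ (t ≤ᵇ inCount S v))

  activated : ℕ → Subset n → ℕ → Subset n
  activated t S zero = S
  activated t S (suc i) = step t (activated t S i)

  -- d(S,t) ≤ k : some i ≤ k has S_i = V
  dLe : Subset n → ℕ → ℕ → Set
  dLe S t k = ∃ λ (i : Fin (suc k)) → activated t S (toℕ i) ≡ ⊤

  -- d_{st}(G) ≤ k : every s-element S has d(S,t) ≤ k
  dstLe : ℕ → ℕ → ℕ → Set
  dstLe s t k = ∀ (S : Subset n) → ∣ S ∣ ≡ s → dLe S t k

  dLe? : ∀ S t k → Dec (dLe S t k)
  dLe? S t k = any? (λ i → VecP.≡-dec BoolP._≟_ (activated t S (toℕ i)) ⊤)

-- A finite group of order n, realised on the carrier Fin n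
-- (every group of order n is isomorphic to one of these).
record FinGroup (n : ℕ) : Set where
  infixl 7 _∙_
  field
    _∙_     : Fin n → Fin n → Fin n
    ε       : Fin n
    _⁻¹     : Fin n → Fin n
    isGroup : IsGroup _≡_ _∙_ ε _⁻¹

Cay : ∀ {n} → FinGroup n → Subset n → Digraph n
Cay {n} Γ H = record
  { Edge  = λ x y → ∃ λ h → h ∈ H × y ≡ h ∙ x
  ; Edge? = λ x y → any? (λ h → (h ∈? H) ×-dec (y Data.Fin.≟ h ∙ x))
  }
  where open FinGroup Γ

open import Data.Fin.Subset.Properties using (anySubset?)
open import Data.Nat using (_≟_)
open import Relation.Nullary using (yes; no)
open import Relation.Nullary.Decidable using (¬?)
open import Data.Empty using (⊥-elim)

dstLe? : ∀ {n} (G : Digraph n) s t k → Dec (dstLe G s t k)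
dstLe? {n} G s t k with anySubset? (λ S → (∣ S ∣ ≟ s) ×-dec ¬? (dLe? G S t k))
... | yes (S , e , ¬d) = no (λ all → ¬d (all S e))
... | no ¬bad = yes λ S e → helper S e
  where
  helper : ∀ S → ∣ S ∣ ≡ s → dLe G S t k
  helper S e with dLe? G S t k
  ... | yes d = d
  ... | no ¬d = ⊥-elim (¬bad (S , e , ¬d))

-- number of h-element subsets of Γ (sample space of the uniform choice of H)
numSubsetsOfSize : ∀ n → ℕ → ℕ
numSubsetsOfSize n h = countSubsets {n} (λ H → ∣ H ∣ ≟ h)

numGood : ∀ {n} → FinGroup n → ℕ → ℕ → ℕ
numGood {n} Γ h s = countSubsets {n} (λ H → (∣ H ∣ ≟ h) ×-dec dstLe? (Cay Γ H) s 1 2)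

-- If every g ∈ Γ is a product y z of two elements of H, then from one active vertex x every
-- v = y z x is active after two rounds, so d_{s1}(Cay(Γ, H)) ≤ 2. Otherwise H avoids some g:
-- no y, z ∈ H have y z = g. For such H the sets H, {x : x⁻¹ g ∈ H} and {x ∉ H : H ∪ {x} avoids g}
-- are disjoint, so double counting pairs (subset, added element) shows that the number B(j) of
-- j-subsets avoiding g satisfies (j + 1) B(j + 1) ≤ (n − 2j) B(j), against
-- (j + 1) C(n, j + 1) = (n − j) C(n, j). Summing over g, the bad fraction is at most
-- n ∏_{i<h} (n − 2i) / (n − i); when h ≥ c n, linearly many of these factors are at most a
-- constant below 1, which beats the factor n.

module Submission where

open import Defs
open import Level using (Level; 0ℓ)
open import Algebra.Bundles using (Group)
open import Algebra.Structures using (IsGroup)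
import Algebra.Properties.Group as GroupProperties
open import Data.Bool using (true; not; if_then_else_; _∨_)
open import Data.Bool.Properties using (T-≡; ∨-zeroʳ)
open import Data.Empty using (⊥-elim)
open import Data.Fin as Fin using (Fin; zero; suc)
open import Data.Fin.Permutation using (permutation)
open import Data.Fin.Properties using (any?; ¬∀⟶∃¬)
open import Data.Fin.Subset using (Subset; _∈_; _∉_; _⊆_; ⊤; ∣_∣; inside; outside)
open import Data.Fin.Subset.Properties using (_∈?_; ∣p∣≤n; ⊆-antisym; ⊆⊤; nonempty?; Empty-unique; ∣⊥∣≡0)
open import Data.List as List using (map; filter; length)
import Data.List.Properties as List
open import Data.List.Membership.Propositional using (lose)
open import Data.List.Membership.Propositional.Properties using (∈-allFin)
open import Data.Nat using (ℕ; zero; suc; _+_; _*_; _∸_; _^_; _≤_; _<_; z≤n; s≤s⁻¹; _≟_; _≤ᵇ_; NonZero; >-nonZero)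
open import Data.Nat.DivMod using (_/_; _%_; m/n*n≤m; m≡m%n+[m/n]*n; m%n<n)
open import Data.Nat.ListAction using () renaming (sum to sumᴸ)
open import Data.Nat.ListAction.Properties using () renaming (sum-++ to sumᴸ-++)
open import Data.Nat.Properties
open import Data.Nat.Solver using (module +-*-Solver)
open import Data.Product using (∃; ∃₂; _×_; _,_)
open import Data.Vec using ([]; _∷_; lookup; _[_]%=_; here; there)
open import Data.Vec.Properties using (updateAt-minimal; lookup⇒[]=; lookup∘tabulate)
open import Function using (_∘_)
open import Function.Bundles using (Equivalence)
open import Relation.Binary.PropositionalEquality
open import Relation.Nullary using (Dec; yes; no; does; ¬_; ¬?; contradiction)
open import Relation.Nullary.Decidable using (dec-true; dec-false; _×-dec_)
open import Algebra.Properties.Semiring.Sum +-*-semiring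
  using (sum; sum-syntax; sum-cong-≗; sum-replicate-zero; sum-remove; ∑-distrib-+; sum-permute;
         *-distribˡ-sum; *-distribʳ-sum)
open import Algebra.Properties.CommutativeSemigroup +-commutativeSemigroup
  using () renaming (interchange to +-interchange)
open import Algebra.Properties.CommutativeSemigroup *-commutativeSemigroup using (x∙yz≈y∙xz)
open +-*-Solver

private variable
  p : Level
  P : Set p
  n : ℕ

-- Indicators and finite sums

-- Defined through does, so that 𝟙 (suc x ∈? s ∷ p) reduces to 𝟙 (x ∈? p).
𝟙 : Dec P → ℕ
𝟙 d = if does d then 1 else 0

𝟙-yes : (d : Dec P) → P → 𝟙 d ≡ 1
𝟙-yes d x rewrite dec-true d x = refl

𝟙-no : (d : Dec P) → ¬ P → 𝟙 d ≡ 0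
𝟙-no d ¬x rewrite dec-false d ¬x = refl

𝟙≤1 : (d : Dec P) → 𝟙 d ≤ 1
𝟙≤1 (yes _) = ≤-refl
𝟙≤1 (no _)  = z≤n

𝟙≟-subst : ∀ m k (f : ℕ → ℕ) → 𝟙 (m ≟ k) * f m ≡ 𝟙 (m ≟ k) * f k
𝟙≟-subst m k f with m ≟ k
... | yes m≡k = cong (λ z → 𝟙 (m ≟ k) * f z) m≡k
... | no  m≢k rewrite 𝟙-no (m ≟ k) m≢k = refl

𝟙≤𝟙-×-dec+ : ∀ {q} {Q : Set q} (P? : Dec P) (Q? : Dec Q) {t} → (P → ¬ Q → 1 ≤ t) →
  𝟙 P? ≤ 𝟙 (P? ×-dec Q?) + t
𝟙≤𝟙-×-dec+ (no  _) Q?      _ = z≤n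
𝟙≤𝟙-×-dec+ (yes _) (yes _) _ = m≤m+n 1 _
𝟙≤𝟙-×-dec+ (yes p) (no ¬q) f = f p ¬q

∑-mono-≤ : {f g : Fin n → ℕ} → (∀ i → f i ≤ g i) → sum f ≤ sum g
∑-mono-≤ {zero}  f≤g = z≤n
∑-mono-≤ {suc n} f≤g = +-mono-≤ (f≤g zero) (∑-mono-≤ (f≤g ∘ suc))

∑-const : ∀ n c → ∑[ _ < n ] c ≡ n * c
∑-const zero    c = refl
∑-const (suc n) c = cong (c +_) (∑-const n c)

f≤∑f : (f : Fin n → ℕ) (i : Fin n) → f i ≤ sum f
f≤∑f {suc n} f i = ≤-trans (m≤m+n (f i) _) (≤-reflexive (sym (sum-remove {i = i} f)))

module _ {a} {A : Set a} where

  sumᴸ-map-mono-≤ : {f g : A → ℕ} → (∀ x → f x ≤ g x) → ∀ xs → sumᴸ (map f xs) ≤ sumᴸ (map g xs)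
  sumᴸ-map-mono-≤ f≤g List.[]       = z≤n
  sumᴸ-map-mono-≤ f≤g (x List.∷ xs) = +-mono-≤ (f≤g x) (sumᴸ-map-mono-≤ f≤g xs)

  sumᴸ-map-distrib-+ : (f g : A → ℕ) → ∀ xs →
    sumᴸ (map (λ x → f x + g x) xs) ≡ sumᴸ (map f xs) + sumᴸ (map g xs)
  sumᴸ-map-distrib-+ f g List.[]       = refl
  sumᴸ-map-distrib-+ f g (x List.∷ xs) = begin
    f x + g x + sumᴸ (map (λ x → f x + g x) xs)     ≡⟨ cong (f x + g x +_) (sumᴸ-map-distrib-+ f g xs) ⟩
    f x + g x + (sumᴸ (map f xs) + sumᴸ (map g xs)) ≡⟨ +-interchange (f x) (g x) _ _ ⟩
    f x + sumᴸ (map f xs) + (g x + sumᴸ (map g xs)) ∎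
    where open ≡-Reasoning

  *-distribˡ-sumᴸ-map : ∀ c (f : A → ℕ) xs → c * sumᴸ (map f xs) ≡ sumᴸ (map (λ x → c * f x) xs)
  *-distribˡ-sumᴸ-map c f List.[]       = *-zeroʳ c
  *-distribˡ-sumᴸ-map c f (x List.∷ xs) =
    trans (*-distribˡ-+ c (f x) _) (cong (c * f x +_) (*-distribˡ-sumᴸ-map c f xs))

  sumᴸ-map-∑-comm : ∀ {m} (f : A → Fin m → ℕ) xs →
    sumᴸ (map (λ x → ∑[ i < m ] f x i) xs) ≡ ∑[ i < m ] sumᴸ (map (λ x → f x i) xs)
  sumᴸ-map-∑-comm {m} f List.[]       = sym (sum-replicate-zero m)
  sumᴸ-map-∑-comm     f (x List.∷ xs) =
    trans (cong (sum (f x) +_) (sumᴸ-map-∑-comm f xs)) (sym (∑-distrib-+ (f x) _))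

length-filter≡sum-𝟙 : ∀ {a} {A : Set a} {P : A → Set p} (P? : ∀ x → Dec (P x)) xs →
  length (filter P? xs) ≡ sumᴸ (map (𝟙 ∘ P?) xs)
length-filter≡sum-𝟙 P? List.[] = refl
length-filter≡sum-𝟙 P? (x List.∷ xs) with P? x
... | yes _ = cong suc (length-filter≡sum-𝟙 P? xs)
... | no _  = length-filter≡sum-𝟙 P? xs

-- Sums over all subsets and double counting

∑ₛ : ∀ n → (Subset n → ℕ) → ℕ
∑ₛ n f = sumᴸ (map f (allSubsets n))

infixl 10 ∑ₛ
syntax ∑ₛ n (λ H → e) = ∑[ H ⊆ n ] e

countSubsets≡∑ₛ𝟙 : {P : Subset n → Set} (P? : ∀ H → Dec (P H)) → countSubsets P? ≡ ∑ₛ n (𝟙 ∘ P?)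
countSubsets≡∑ₛ𝟙 {n} P? = length-filter≡sum-𝟙 P? (allSubsets n)

∑ₛ-cong : {f g : Subset n → ℕ} → (∀ H → f H ≡ g H) → ∑ₛ n f ≡ ∑ₛ n g
∑ₛ-cong {n} f≗g = cong sumᴸ (List.map-cong f≗g (allSubsets n))

∑ₛ-∷ : (f : Subset (suc n) → ℕ) → ∑ₛ (suc n) f ≡ ∑ₛ n (f ∘ (inside ∷_)) + ∑ₛ n (f ∘ (outside ∷_))
∑ₛ-∷ {n} f = begin
  sumᴸ (map f (map (inside ∷_) Hs List.++ map (outside ∷_) Hs))
    ≡⟨ cong sumᴸ (List.map-++ f (map (inside ∷_) Hs) _) ⟩
  sumᴸ (map f (map (inside ∷_) Hs) List.++ map f (map (outside ∷_) Hs))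
    ≡⟨ sumᴸ-++ (map f (map (inside ∷_) Hs)) _ ⟩
  sumᴸ (map f (map (inside ∷_) Hs)) + sumᴸ (map f (map (outside ∷_) Hs))
    ≡⟨ sym (cong₂ _+_ (cong sumᴸ (List.map-∘ Hs)) (cong sumᴸ (List.map-∘ Hs))) ⟩
  ∑ₛ n (f ∘ (inside ∷_)) + ∑ₛ n (f ∘ (outside ∷_)) ∎
  where open ≡-Reasoning
        Hs = allSubsets n

∣p∣≡∑𝟙∈ : (p : Subset n) → ∣ p ∣ ≡ ∑[ x < n ] 𝟙 (x ∈? p)
∣p∣≡∑𝟙∈ []    = refl
∣p∣≡∑𝟙∈ (inside  ∷ p) = cong suc (∣p∣≡∑𝟙∈ p)
∣p∣≡∑𝟙∈ (outside ∷ p) = ∣p∣≡∑𝟙∈ p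

∑𝟙∉≡n∸∣p∣ : (p : Subset n) → ∑[ x < n ] 𝟙 (¬? (x ∈? p)) ≡ n ∸ ∣ p ∣
∑𝟙∉≡n∸∣p∣ []    = refl
∑𝟙∉≡n∸∣p∣ (inside  ∷ p) = ∑𝟙∉≡n∸∣p∣ p
∑𝟙∉≡n∸∣p∣ (outside ∷ p) = trans (cong suc (∑𝟙∉≡n∸∣p∣ p)) (sym (+-∸-assoc 1 (∣p∣≤n p)))

toggle : Fin n → Subset n → Subset n
toggle x H = H [ x ]%= not

x∈toggle : ∀ {x : Fin n} {H} → x ∉ H → x ∈ toggle x H
x∈toggle {x = zero}  {outside ∷ H} x∉H = here
x∈toggle {x = zero}  {inside  ∷ H} x∉H = ⊥-elim (x∉H here)
x∈toggle {x = suc x} {_       ∷ H} x∉H = there (x∈toggle (x∉H ∘ there))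

x∉toggle : ∀ {x : Fin n} {H} → x ∈ H → x ∉ toggle x H
x∉toggle {x = suc x} {_ ∷ H} (there x∈H) (there x∈H′) = x∉toggle x∈H x∈H′

∈-toggle : ∀ {x y : Fin n} {H} → y ∈ H → y ≢ x → y ∈ toggle x H
∈-toggle {x = x} {y} {H} y∈H y≢x = updateAt-minimal y x H y≢x y∈H

∣toggle∣ : ∀ {x : Fin n} {H} → x ∉ H → ∣ toggle x H ∣ ≡ suc ∣ H ∣
∣toggle∣ {x = zero}  {outside ∷ H} x∉H = refl
∣toggle∣ {x = zero}  {inside  ∷ H} x∉H = ⊥-elim (x∉H here)
∣toggle∣ {x = suc x} {outside ∷ H} x∉H = ∣toggle∣ (x∉H ∘ there)
∣toggle∣ {x = suc x} {inside  ∷ H} x∉H = cong suc (∣toggle∣ (x∉H ∘ there))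

∑ₛ-toggle : ∀ (x : Fin n) (f : Subset n → ℕ) → ∑ₛ n (f ∘ toggle x) ≡ ∑ₛ n f
∑ₛ-toggle {suc n} zero f = begin
  ∑ₛ (suc n) (f ∘ toggle zero)                      ≡⟨ ∑ₛ-∷ (f ∘ toggle zero) ⟩
  ∑ₛ n (f ∘ (outside ∷_)) + ∑ₛ n (f ∘ (inside ∷_))  ≡⟨ +-comm (∑ₛ n (f ∘ (outside ∷_))) _ ⟩
  ∑ₛ n (f ∘ (inside ∷_)) + ∑ₛ n (f ∘ (outside ∷_))  ≡⟨ ∑ₛ-∷ f ⟨
  ∑ₛ (suc n) f                                      ∎
  where open ≡-Reasoning
∑ₛ-toggle {suc n} (suc x) f = begin
  ∑ₛ (suc n) (f ∘ toggle (suc x))                   ≡⟨ ∑ₛ-∷ (f ∘ toggle (suc x)) ⟩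
  ∑ₛ n (f ∘ (inside ∷_) ∘ toggle x) + ∑ₛ n (f ∘ (outside ∷_) ∘ toggle x)
    ≡⟨ cong₂ _+_ (∑ₛ-toggle x (f ∘ (inside ∷_))) (∑ₛ-toggle x (f ∘ (outside ∷_))) ⟩
  ∑ₛ n (f ∘ (inside ∷_)) + ∑ₛ n (f ∘ (outside ∷_))  ≡⟨ ∑ₛ-∷ f ⟨
  ∑ₛ (suc n) f                                      ∎
  where open ≡-Reasoning

⊆-toggle : ∀ {x : Fin n} {H} → x ∉ H → H ⊆ toggle x H
⊆-toggle x∉H y∈H = ∈-toggle y∈H (λ y≡x → x∉H (subst (_∈ _) y≡x y∈H))

sizedSum : ∀ n → ℕ → (Subset n → ℕ) → ℕ
sizedSum n j w = ∑[ H ⊆ n ] (𝟙 (∣ H ∣ ≟ j) * w H)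

size-as-∑-members : ∀ k c (H : Subset n) →
  k * (𝟙 (∣ H ∣ ≟ k) * c) ≡ ∑[ x < n ] (𝟙 (∣ H ∣ ≟ k) * c * 𝟙 (x ∈? H))
size-as-∑-members {n} k c H = begin
  k * (a * c)                   ≡⟨ *-comm k (a * c) ⟩
  a * c * k                     ≡⟨ *-assoc a c k ⟩
  a * (c * k)                   ≡⟨ 𝟙≟-subst ∣ H ∣ k (c *_) ⟨
  a * (c * ∣ H ∣)               ≡⟨ *-assoc a c ∣ H ∣ ⟨
  a * c * ∣ H ∣                 ≡⟨ cong (a * c *_) (∣p∣≡∑𝟙∈ H) ⟩
  a * c * ∑[ x < n ] 𝟙 (x ∈? H) ≡⟨ *-distribˡ-sum (a * c) (λ x → 𝟙 (x ∈? H)) ⟩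
  ∑[ x < n ] (a * c * 𝟙 (x ∈? H)) ∎
  where open ≡-Reasoning
        a = 𝟙 (∣ H ∣ ≟ k)

-- Adding x to a j-subset not containing it is a bijection onto the pairs (j+1-subset, member x).
toggle-pairing : ∀ j (w : Subset n → ℕ) H x →
  𝟙 (∣ toggle x H ∣ ≟ suc j) * w (toggle x H) * 𝟙 (x ∈? toggle x H)
    ≡ 𝟙 (∣ H ∣ ≟ j) * (𝟙 (¬? (x ∈? H)) * w (toggle x H))
toggle-pairing j w H x with x ∈? H
... | yes x∈H rewrite 𝟙-no (x ∈? toggle x H) (x∉toggle x∈H) =
  trans (*-zeroʳ (𝟙 (∣ toggle x H ∣ ≟ suc j) * w (toggle x H))) (sym (*-zeroʳ (𝟙 (∣ H ∣ ≟ j))))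
... | no  x∉H rewrite 𝟙-yes (x ∈? toggle x H) (x∈toggle x∉H) | ∣toggle∣ x∉H =
  trans (*-identityʳ (𝟙 (∣ H ∣ ≟ j) * w (toggle x H))) (cong (𝟙 (∣ H ∣ ≟ j) *_) (sym (*-identityˡ (w (toggle x H)))))

double-count : ∀ j (w : Subset n → ℕ) →
  suc j * sizedSum n (suc j) w
    ≡ ∑[ H ⊆ n ] (𝟙 (∣ H ∣ ≟ j) * ∑[ x < n ] (𝟙 (¬? (x ∈? H)) * w (toggle x H)))
double-count {n} j w = begin
  suc j * sizedSum n (suc j) w
    ≡⟨ *-distribˡ-sumᴸ-map (suc j) (λ H → 𝟙 (∣ H ∣ ≟ suc j) * w H) Hs ⟩
  ∑[ H ⊆ n ] (suc j * (𝟙 (∣ H ∣ ≟ suc j) * w H))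
    ≡⟨ ∑ₛ-cong (λ H → size-as-∑-members (suc j) (w H) H) ⟩
  ∑[ H ⊆ n ] (∑[ x < n ] (member H x))
    ≡⟨ sumᴸ-map-∑-comm member Hs ⟩
  ∑[ x < n ] ∑[ H ⊆ n ] (member H x)
    ≡⟨ sum-cong-≗ (λ x → ∑ₛ-toggle x (λ H → member H x)) ⟨
  ∑[ x < n ] ∑[ H ⊆ n ] (member (toggle x H) x)
    ≡⟨ sum-cong-≗ (λ x → ∑ₛ-cong (λ H → toggle-pairing j w H x)) ⟩
  ∑[ x < n ] ∑[ H ⊆ n ] (added H x)
    ≡⟨ sumᴸ-map-∑-comm added Hs ⟨
  ∑[ H ⊆ n ] (∑[ x < n ] (added H x))
    ≡⟨ ∑ₛ-cong (λ H → *-distribˡ-sum (𝟙 (∣ H ∣ ≟ j)) (λ x → 𝟙 (¬? (x ∈? H)) * w (toggle x H))) ⟨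
  ∑[ H ⊆ n ] (𝟙 (∣ H ∣ ≟ j) * ∑[ x < n ] (𝟙 (¬? (x ∈? H)) * w (toggle x H))) ∎
  where
  open ≡-Reasoning
  Hs = allSubsets n
  member added : Subset n → Fin n → ℕ
  member H x = 𝟙 (∣ H ∣ ≟ suc j) * w H * 𝟙 (x ∈? H)
  added  H x = 𝟙 (∣ H ∣ ≟ j) * (𝟙 (¬? (x ∈? H)) * w (toggle x H))

numSubsetsOfSize-suc : ∀ n j → suc j * numSubsetsOfSize n (suc j) ≡ (n ∸ j) * numSubsetsOfSize n j
numSubsetsOfSize-suc n j = begin
  suc j * numSubsetsOfSize n (suc j)
    ≡⟨ cong (suc j *_) (countSubsets≡∑ₛ𝟙 {n} (λ H → ∣ H ∣ ≟ suc j)) ⟩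
  suc j * ∑[ H ⊆ n ] (𝟙 (∣ H ∣ ≟ suc j))
    ≡⟨ cong (suc j *_) (∑ₛ-cong {n} (λ H → *-identityʳ (𝟙 (∣ H ∣ ≟ suc j)))) ⟨
  suc j * sizedSum n (suc j) (λ _ → 1)
    ≡⟨ double-count {n} j (λ _ → 1) ⟩
  ∑[ H ⊆ n ] (𝟙 (∣ H ∣ ≟ j) * ∑[ x < n ] (𝟙 (¬? (x ∈? H)) * 1))
    ≡⟨ ∑ₛ-cong {n} (λ H → cong (𝟙 (∣ H ∣ ≟ j) *_) (non-members H)) ⟩
  ∑[ H ⊆ n ] (𝟙 (∣ H ∣ ≟ j) * (n ∸ ∣ H ∣))
    ≡⟨ ∑ₛ-cong {n} (λ H → 𝟙≟-subst ∣ H ∣ j (n ∸_)) ⟩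
  ∑[ H ⊆ n ] (𝟙 (∣ H ∣ ≟ j) * (n ∸ j))
    ≡⟨ ∑ₛ-cong {n} (λ H → *-comm (𝟙 (∣ H ∣ ≟ j)) (n ∸ j)) ⟩
  ∑[ H ⊆ n ] ((n ∸ j) * 𝟙 (∣ H ∣ ≟ j))
    ≡⟨ *-distribˡ-sumᴸ-map (n ∸ j) (λ H → 𝟙 (∣ H ∣ ≟ j)) (allSubsets n) ⟨
  (n ∸ j) * ∑[ H ⊆ n ] (𝟙 (∣ H ∣ ≟ j))
    ≡⟨ cong ((n ∸ j) *_) (countSubsets≡∑ₛ𝟙 {n} (λ H → ∣ H ∣ ≟ j)) ⟨
  (n ∸ j) * numSubsetsOfSize n j ∎
  where
  open ≡-Reasoning
  non-members : (H : Subset n) → ∑[ x < n ] (𝟙 (¬? (x ∈? H)) * 1) ≡ n ∸ ∣ H ∣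
  non-members H = trans (sum-cong-≗ (λ x → *-identityʳ (𝟙 (¬? (x ∈? H))))) (∑𝟙∉≡n∸∣p∣ H)

sizedSum-≤-numSubsetsOfSize : ∀ n j (w : Subset n → ℕ) → (∀ H → w H ≤ 1) →
  sizedSum n j w ≤ numSubsetsOfSize n j
sizedSum-≤-numSubsetsOfSize n j w w≤1 = begin
  ∑[ H ⊆ n ] (𝟙 (∣ H ∣ ≟ j) * w H) ≤⟨ sumᴸ-map-mono-≤ (λ H → *-monoʳ-≤ (𝟙 (∣ H ∣ ≟ j)) (w≤1 H)) (allSubsets n) ⟩
  ∑[ H ⊆ n ] (𝟙 (∣ H ∣ ≟ j) * 1)   ≡⟨ ∑ₛ-cong {n} (λ H → *-identityʳ (𝟙 (∣ H ∣ ≟ j))) ⟩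
  ∑[ H ⊆ n ] (𝟙 (∣ H ∣ ≟ j))       ≡⟨ countSubsets≡∑ₛ𝟙 {n} (λ H → ∣ H ∣ ≟ j) ⟨
  numSubsetsOfSize n j             ∎
  where open ≤-Reasoning

-- Falling products

∏ : (ℕ → ℕ) → ℕ → ℕ
∏ f zero    = 1
∏ f (suc j) = ∏ f j * f j

∏-mono-≤ : ∀ {f g} → (∀ i → f i ≤ g i) → ∀ j → ∏ f j ≤ ∏ g j
∏-mono-≤ f≤g zero    = ≤-refl
∏-mono-≤ f≤g (suc j) = *-mono-≤ (∏-mono-≤ f≤g j) (f≤g j)

recurrence-comparison : (A B d e : ℕ → ℕ) →
  (∀ j → suc j * A (suc j) ≡ d j * A j) → (∀ j → suc j * B (suc j) ≤ e j * B j) → B 0 ≤ A 0 →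
  ∀ j → B j * ∏ d j ≤ A j * ∏ e j
recurrence-comparison A B d e A-rec B-rec B₀≤A₀ zero = *-monoˡ-≤ 1 B₀≤A₀
recurrence-comparison A B d e A-rec B-rec B₀≤A₀ (suc j) = *-cancelˡ-≤ (suc j) (begin
  suc j * (B (suc j) * (∏ d j * d j))   ≡⟨ solve 4 (λ s b p q → s :* (b :* (p :* q)) := (s :* b) :* (p :* q)) refl (suc j) (B (suc j)) (∏ d j) (d j) ⟩
  (suc j * B (suc j)) * (∏ d j * d j)   ≤⟨ *-monoˡ-≤ (∏ d j * d j) (B-rec j) ⟩
  (e j * B j) * (∏ d j * d j)           ≡⟨ solve 4 (λ x b p q → (x :* b) :* (p :* q) := (x :* q) :* (b :* p)) refl (e j) (B j) (∏ d j) (d j) ⟩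
  (e j * d j) * (B j * ∏ d j)           ≤⟨ *-monoʳ-≤ (e j * d j) (recurrence-comparison A B d e A-rec B-rec B₀≤A₀ j) ⟩
  (e j * d j) * (A j * ∏ e j)           ≡⟨ solve 4 (λ x q a p → (x :* q) :* (a :* p) := (q :* a) :* (p :* x)) refl (e j) (d j) (A j) (∏ e j) ⟩
  (d j * A j) * (∏ e j * e j)           ≡⟨ cong (_* (∏ e j * e j)) (A-rec j) ⟨
  (suc j * A (suc j)) * (∏ e j * e j)   ≡⟨ *-assoc (suc j) (A (suc j)) (∏ e j * e j) ⟩
  suc j * (A (suc j) * (∏ e j * e j))   ∎)
  where open ≤-Reasoning

falling falling₂ : ℕ → ℕ → ℕ
falling  n = ∏ (λ i → n ∸ i)
falling₂ n = ∏ (λ i → n ∸ (i + i))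

falling₂≤falling : ∀ n j → falling₂ n j ≤ falling n j
falling₂≤falling n = ∏-mono-≤ (λ i → ∸-monoʳ-≤ n (m≤m+n i i))

falling≢0 : ∀ n j → j ≤ n → NonZero (falling n j)
falling≢0 n zero    _   = _
falling≢0 n (suc j) j<n = m*n≢0 (falling n j) (n ∸ j) {{falling≢0 n j (<⇒≤ j<n)}} {{>-nonZero (m<n⇒0<n∸m j<n)}}

ratio-step : ∀ r n i → n ≤ suc (suc r) * i → suc r * (n ∸ (i + i)) ≤ r * (n ∸ i)
ratio-step r n i n≤[2+r]i = begin
  suc r * (n ∸ (i + i))   ≡⟨ cong (suc r *_) (∸-+-assoc n i i) ⟨
  suc r * (n ∸ i ∸ i)     ≡⟨ *-distribˡ-∸ (suc r) (n ∸ i) i ⟩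
  suc r * (n ∸ i) ∸ suc r * i ≤⟨ ∸-monoʳ-≤ (suc r * (n ∸ i)) n∸i≤[1+r]i ⟩
  suc r * (n ∸ i) ∸ (n ∸ i)   ≡⟨ m+n∸m≡n (n ∸ i) (r * (n ∸ i)) ⟩
  r * (n ∸ i)             ∎
  where
  open ≤-Reasoning
  n∸i≤[1+r]i : n ∸ i ≤ suc r * i
  n∸i≤[1+r]i = ≤-trans (∸-monoˡ-≤ i n≤[2+r]i) (≤-reflexive (m+n∸m≡n i (suc r * i)))

falling₂-decay : ∀ r n i₀ → n ≤ suc (suc r) * i₀ → ∀ t →
  falling₂ n (t + i₀) * suc r ^ t ≤ falling n (t + i₀) * r ^ t
falling₂-decay r n i₀ n≤ zero    = *-monoˡ-≤ 1 (falling₂≤falling n i₀)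
falling₂-decay r n i₀ n≤ (suc t) = begin
  falling₂ n i * (n ∸ (i + i)) * (suc r * X)
    ≡⟨ solve 4 (λ q u s x → q :* u :* (s :* x) := (q :* x) :* (s :* u)) refl (falling₂ n i) (n ∸ (i + i)) (suc r) X ⟩
  (falling₂ n i * X) * (suc r * (n ∸ (i + i)))
    ≤⟨ *-mono-≤ (falling₂-decay r n i₀ n≤ t) (ratio-step r n i (≤-trans n≤ (*-monoʳ-≤ (suc (suc r)) (m≤n+m i₀ t)))) ⟩
  (falling n i * Y) * (r * (n ∸ i))
    ≡⟨ solve 4 (λ p u s y → (p :* y) :* (s :* u) := p :* u :* (s :* y)) refl (falling n i) (n ∸ i) r Y ⟩
  falling n i * (n ∸ i) * (r * Y) ∎
  where
  open ≤-Reasoning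
  i = t + i₀
  X = suc r ^ t
  Y = r ^ t

-- The first three binomial terms: (1 + 1/r)^L ≥ 1 + L/r + L(L-1)/(2r²).
pow-suc-quadratic-bound : ∀ r L → r ^ L * (2 * r * r + 2 * r * L + L * (L ∸ 1)) ≤ 2 * r * r * suc r ^ L
pow-suc-quadratic-bound r zero =
  ≤-reflexive (solve 1 (λ r → con 1 :* (con 2 :* r :* r :+ con 2 :* r :* con 0 :+ con 0) := con 2 :* r :* r :* con 1) refl r)
pow-suc-quadratic-bound r (suc L) = begin
  r * X * (2 * r * r + 2 * r * suc L + suc L * L)
    ≡⟨ cong (λ z → r * X * (2 * r * r + 2 * r * suc L + z)) (sucL*L L) ⟩
  r * X * (2 * r * r + 2 * r * suc L + (M + (L + L)))
    ≤⟨ m≤m+n _ (X * M) ⟩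
  r * X * (2 * r * r + 2 * r * suc L + (M + (L + L))) + X * M
    ≡⟨ solve 4 (λ r X L M → r :* X :* (con 2 :* r :* r :+ con 2 :* r :* (con 1 :+ L) :+ (M :+ (L :+ L))) :+ X :* M
                   := (con 1 :+ r) :* (X :* (con 2 :* r :* r :+ con 2 :* r :* L :+ M))) refl r X L M ⟩
  suc r * (X * (2 * r * r + 2 * r * L + M))
    ≤⟨ *-monoʳ-≤ (suc r) (pow-suc-quadratic-bound r L) ⟩
  suc r * (2 * r * r * suc r ^ L)
    ≡⟨ x∙yz≈y∙xz (suc r) (2 * r * r) (suc r ^ L) ⟩
  2 * r * r * (suc r * suc r ^ L) ∎
  where
  open ≤-Reasoning
  X = r ^ L
  M = L * (L ∸ 1)
  sucL*L : ∀ L → suc L * L ≡ L * (L ∸ 1) + (L + L)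
  sucL*L zero    = refl
  sucL*L (suc l) = solve 1 (λ l → (con 2 :+ l) :* (con 1 :+ l) := (con 1 :+ l) :* l :+ ((con 1 :+ l) :+ (con 1 :+ l))) refl l

linear*pow≤pow-suc : ∀ r C L → 2 * suc r * suc r * C + 2 ≤ L → C * suc L * suc r ^ L ≤ suc (suc r) ^ L
linear*pow≤pow-suc r C L K+2≤L = *-cancelˡ-≤ (2 * suc r * suc r) (begin
  R * (C * suc L * X)  ≡⟨ solve 4 (λ R C L X → R :* (C :* (con 1 :+ L) :* X) := X :* (R :* C :* (con 1 :+ L))) refl R C L X ⟩
  X * (K * suc L)      ≤⟨ *-monoʳ-≤ X K[1+L]≤L[L-1] ⟩
  X * (L * (L ∸ 1))    ≤⟨ *-monoʳ-≤ X (m≤n+m (L * (L ∸ 1)) (R + 2 * suc r * L)) ⟩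
  X * (R + 2 * suc r * L + L * (L ∸ 1)) ≤⟨ pow-suc-quadratic-bound (suc r) L ⟩
  R * suc (suc r) ^ L  ∎)
  where
  open ≤-Reasoning
  R = 2 * suc r * suc r
  K = R * C
  X = suc r ^ L
  K[1+L]≤L[L-1] : K * suc L ≤ L * (L ∸ 1)
  K[1+L]≤L[L-1] = begin
    K * suc L     ≡⟨ *-suc K L ⟩
    K + K * L     ≤⟨ +-monoˡ-≤ (K * L) (≤-trans (m≤m+n K 2) K+2≤L) ⟩
    L + K * L     ≡⟨ cong (L +_) (*-comm K L) ⟩
    L + L * K     ≡⟨ *-suc L K ⟨
    L * suc K     ≤⟨ *-monoʳ-≤ L (m+n≤o⇒m≤o∸n (suc K) (≤-trans (≤-reflexive (sym (+-suc K 1))) K+2≤L)) ⟩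
    L * (L ∸ 1)   ∎

-- The last ⌊n / (r + 2)⌋ factors (n − 2i) / (n − i) have i ≥ n / (r + 2), so each is at most r / (r + 1).
falling₂-tail-decay : ∀ r n h → n + n ≤ suc (suc r) * h →
  falling₂ n h * suc r ^ (n / suc (suc r)) ≤ falling n h * r ^ (n / suc (suc r))
falling₂-tail-decay r n h 2n≤Rh =
  subst (λ i → falling₂ n i * suc r ^ L ≤ falling n i * r ^ L) (m+[n∸m]≡n L≤h) (falling₂-decay r n (h ∸ L) n≤R[h∸L] L)
  where
  open ≤-Reasoning
  R = suc (suc r)
  L = n / R
  RL≤n : R * L ≤ n
  RL≤n = ≤-trans (≤-reflexive (*-comm R L)) (m/n*n≤m n R)
  L≤h : L ≤ h
  L≤h = *-cancelˡ-≤ R (≤-trans RL≤n (≤-trans (m≤m+n n n) 2n≤Rh))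
  n≤R[h∸L] : n ≤ R * (h ∸ L)
  n≤R[h∸L] = begin
    n               ≡⟨ m+n∸m≡n n n ⟨
    n + n ∸ n       ≤⟨ ∸-mono 2n≤Rh RL≤n ⟩
    R * h ∸ R * L   ≡⟨ *-distribˡ-∸ R h L ⟨
    R * (h ∸ L)     ∎

falling₂/falling-vanishes : ∀ b k → ∃ λ N → ∀ n h → N ≤ n → n ≤ b * h → suc k * n * falling₂ n h ≤ falling n h
falling₂/falling-vanishes b k = N , bound
  where
  r  = b + b
  R  = suc (suc (suc r))
  C  = suc k * R
  L₀ = 2 * suc r * suc r * C + 2
  N  = R * suc L₀
  bound : ∀ n h → N ≤ n → n ≤ b * h → suc k * n * falling₂ n h ≤ falling n h
  bound n h N≤n n≤bh = *-cancelʳ-≤ (suc k * n * falling₂ n h) (falling n h) Y {{m^n≢0 (suc r) L}} (begin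
    suc k * n * falling₂ n h * Y   ≡⟨ solve 4 (λ k n q y → k :* n :* q :* y := k :* n :* y :* q) refl (suc k) n (falling₂ n h) Y ⟩
    suc k * n * Y * falling₂ n h   ≤⟨ *-monoˡ-≤ (falling₂ n h) (*-monoˡ-≤ Y k·n≤C[1+L]) ⟩
    C * suc L * Y * falling₂ n h   ≤⟨ *-monoˡ-≤ (falling₂ n h) (linear*pow≤pow-suc r C L L₀≤L) ⟩
    suc (suc r) ^ L * falling₂ n h ≡⟨ *-comm (suc (suc r) ^ L) (falling₂ n h) ⟩
    falling₂ n h * suc (suc r) ^ L ≤⟨ falling₂-tail-decay (suc r) n h 2n≤Rh ⟩
    falling n h * Y                ∎)
    where
    open ≤-Reasoning
    L = n / R
    Y = suc r ^ L
    n<R[1+L] : n < R * suc L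
    n<R[1+L] = begin-strict
      n               ≡⟨ m≡m%n+[m/n]*n n R ⟩
      n % R + L * R   <⟨ +-monoˡ-< (L * R) (m%n<n n R) ⟩
      R + L * R       ≡⟨ *-comm (suc L) R ⟩
      R * suc L       ∎
    2n≤Rh : n + n ≤ R * h
    2n≤Rh = begin
      n + n           ≤⟨ +-mono-≤ n≤bh n≤bh ⟩
      b * h + b * h   ≡⟨ *-distribʳ-+ h b b ⟨
      r * h           ≤⟨ *-monoˡ-≤ h (m≤n+m r 3) ⟩
      R * h           ∎
    L₀≤L : L₀ ≤ L
    L₀≤L = s≤s⁻¹ (*-cancelˡ-≤ R (≤-trans N≤n (<⇒≤ n<R[1+L])))
    k·n≤C[1+L] : suc k * n ≤ C * suc L
    k·n≤C[1+L] = ≤-trans (*-monoʳ-≤ (suc k) (<⇒≤ n<R[1+L])) (≤-reflexive (sym (*-assoc (suc k) R (suc L))))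

-- Avoided products and the Cayley digraph

edge-activates : ∀ {n} (G : Digraph n) {T u v} → u ∈ T → Digraph.Edge G u v → v ∈ step G 1 T
edge-activates G {T} {u} {v} u∈T uv = lookup⇒[]= v (step G 1 T) (begin
  lookup (step G 1 T) v              ≡⟨ lookup∘tabulate (λ w → lookup T w ∨ (1 ≤ᵇ inCount G T w)) v ⟩
  lookup T v ∨ (1 ≤ᵇ inCount G T v)  ≡⟨ cong (lookup T v ∨_) (Equivalence.to T-≡ (≤⇒≤ᵇ has-in-neighbour)) ⟩
  lookup T v ∨ true                  ≡⟨ ∨-zeroʳ (lookup T v) ⟩
  true                               ∎)
  where
  open ≡-Reasoning
  has-in-neighbour : 0 < inCount G T v
  has-in-neighbour = List.filter-some (λ w → (w ∈? T) ×-dec Digraph.Edge? G w v) (lose (∈-allFin u) (u∈T , uv))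

module _ {n} (Γ : FinGroup n) where
  open FinGroup Γ
  open IsGroup isGroup using (_\\_; _//_; assoc)
  private
    group : Group 0ℓ 0ℓ
    group = record { isGroup = isGroup }
  open GroupProperties group
    using (\\-leftDividesˡ; //-rightDividesˡ; ⁻¹-anti-homo-\\; ⁻¹-anti-homo-//)

  InSquare : Subset n → Fin n → Set
  InSquare H g = ∃₂ λ y z → y ∈ H × z ∈ H × y ∙ z ≡ g

  inSquare? : ∀ H g → Dec (InSquare H g)
  inSquare? H g = any? λ y → any? λ z → (y ∈? H) ×-dec (z ∈? H) ×-dec (y ∙ z Fin.≟ g)

  InSquare-mono : ∀ {H H′ g} → H ⊆ H′ → InSquare H g → InSquare H′ g
  InSquare-mono H⊆H′ (y , z , y∈H , z∈H , yz≡g) = y , z , H⊆H′ y∈H , H⊆H′ z∈H , yz≡g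

  avoids : Fin n → Subset n → ℕ
  avoids g H = 𝟙 (¬? (inSquare? H g))

  ∑-∘-\\ : ∀ g (f : Fin n → ℕ) → sum f ≡ ∑[ x < n ] f (x \\ g)
  ∑-∘-\\ g f = sum-permute f (permutation (_\\ g) (g //_) left right)
    where
    left : ∀ y → (g // y) \\ g ≡ y
    left y = trans (cong (_∙ g) (⁻¹-anti-homo-// g y)) (//-rightDividesˡ g y)
    right : ∀ x → g // (x \\ g) ≡ x
    right x = trans (cong (g ∙_) (⁻¹-anti-homo-\\ x g)) (\\-leftDividesˡ g x)

  -- For H avoiding g: H, {x : x \\ g ∈ H} and {x ∉ H : toggle x H avoids g} are disjoint.
  avoiding-pointwise : ∀ {g H} → ¬ InSquare H g → ∀ x →
    𝟙 (¬? (x ∈? H)) * avoids g (toggle x H) + 𝟙 (x ∈? H) + 𝟙 (x \\ g ∈? H) ≤ 1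
  avoiding-pointwise {g} {H} ¬sq x with x ∈? H | x \\ g ∈? H
  ... | yes x∈H | yes x\\g∈H = ⊥-elim (¬sq (x , x \\ g , x∈H , x\\g∈H , \\-leftDividesˡ x g))
  ... | yes _   | no  _      = ≤-refl
  ... | no  x∉H | yes x\\g∈H =
    ≤-reflexive (cong (λ a → 1 * a + 0 + 1) (𝟙-no (¬? (inSquare? (toggle x H) g)) (λ ¬sq′ → ¬sq′ witness)))
    where
    witness : InSquare (toggle x H) g
    witness = x , x \\ g , x∈toggle x∉H , ∈-toggle x\\g∈H (λ eq → x∉H (subst (_∈ H) eq x\\g∈H)) , \\-leftDividesˡ x g
  ... | no  _   | no  _      = ≤-trans (≤-reflexive drop-zeros) (𝟙≤1 (¬? (inSquare? (toggle x H) g)))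
    where
    a = avoids g (toggle x H)
    drop-zeros : 1 * a + 0 + 0 ≡ a
    drop-zeros = trans (+-identityʳ (1 * a + 0)) (trans (+-identityʳ (1 * a)) (*-identityˡ a))

  extensions-bound : ∀ g H →
    ∑[ x < n ] (𝟙 (¬? (x ∈? H)) * avoids g (toggle x H)) ≤ (n ∸ (∣ H ∣ + ∣ H ∣)) * avoids g H
  extensions-bound g H with inSquare? H g
  ... | yes sq = ≤-trans (≤-reflexive (trans (sum-cong-≗ blocked) (sum-replicate-zero n))) z≤n
    where
    blocked : ∀ x → 𝟙 (¬? (x ∈? H)) * avoids g (toggle x H) ≡ 0
    blocked x with x ∈? H
    ... | yes _   = refl
    ... | no  x∉H = trans (*-identityˡ (avoids g (toggle x H)))
                      (𝟙-no (¬? (inSquare? (toggle x H) g)) (λ ¬sq′ → ¬sq′ (InSquare-mono (⊆-toggle x∉H) sq)))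
  ... | no ¬sq = ≤-trans (m+n≤o⇒m≤o∸n (sum e) counted) (≤-reflexive (sym (*-identityʳ (n ∸ (∣ H ∣ + ∣ H ∣)))))
    where
    e m m′ : Fin n → ℕ
    e  x = 𝟙 (¬? (x ∈? H)) * avoids g (toggle x H)
    m  x = 𝟙 (x ∈? H)
    m′ x = 𝟙 (x \\ g ∈? H)
    counted : sum e + (∣ H ∣ + ∣ H ∣) ≤ n
    counted = begin
      sum e + (∣ H ∣ + ∣ H ∣)     ≡⟨ cong₂ (λ a b → sum e + (a + b)) (∣p∣≡∑𝟙∈ H) (trans (∣p∣≡∑𝟙∈ H) (∑-∘-\\ g m)) ⟩
      sum e + (sum m + sum m′)    ≡⟨ +-assoc (sum e) (sum m) (sum m′) ⟨
      sum e + sum m + sum m′      ≡⟨ cong (_+ sum m′) (∑-distrib-+ e m) ⟨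
      sum (λ x → e x + m x) + sum m′ ≡⟨ ∑-distrib-+ (λ x → e x + m x) m′ ⟨
      ∑[ x < n ] (e x + m x + m′ x) ≤⟨ ∑-mono-≤ (avoiding-pointwise ¬sq) ⟩
      ∑[ _ < n ] 1                 ≡⟨ ∑-const n 1 ⟩
      n * 1                        ≡⟨ *-identityʳ n ⟩
      n                            ∎
      where open ≤-Reasoning

  sizedSum-avoids-suc : ∀ g j →
    suc j * sizedSum n (suc j) (avoids g) ≤ (n ∸ (j + j)) * sizedSum n j (avoids g)
  sizedSum-avoids-suc g j = begin
    suc j * sizedSum n (suc j) (avoids g)
      ≡⟨ double-count j (avoids g) ⟩
    ∑[ H ⊆ n ] (𝟙 (∣ H ∣ ≟ j) * ∑[ x < n ] (𝟙 (¬? (x ∈? H)) * avoids g (toggle x H)))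
      ≤⟨ sumᴸ-map-mono-≤ (λ H → *-monoʳ-≤ (𝟙 (∣ H ∣ ≟ j)) (extensions-bound g H)) (allSubsets n) ⟩
    ∑[ H ⊆ n ] (𝟙 (∣ H ∣ ≟ j) * ((n ∸ (∣ H ∣ + ∣ H ∣)) * avoids g H))
      ≡⟨ ∑ₛ-cong (λ H → 𝟙≟-subst ∣ H ∣ j (λ m → (n ∸ (m + m)) * avoids g H)) ⟩
    ∑[ H ⊆ n ] (𝟙 (∣ H ∣ ≟ j) * ((n ∸ (j + j)) * avoids g H))
      ≡⟨ ∑ₛ-cong (λ H → x∙yz≈y∙xz (𝟙 (∣ H ∣ ≟ j)) (n ∸ (j + j)) (avoids g H)) ⟩
    ∑[ H ⊆ n ] ((n ∸ (j + j)) * (𝟙 (∣ H ∣ ≟ j) * avoids g H))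
      ≡⟨ *-distribˡ-sumᴸ-map (n ∸ (j + j)) (λ H → 𝟙 (∣ H ∣ ≟ j) * avoids g H) (allSubsets n) ⟨
    (n ∸ (j + j)) * sizedSum n j (avoids g) ∎
    where open ≤-Reasoning

  Cay-covered-in-two-rounds : ∀ {H S x} → (∀ g → InSquare H g) → x ∈ S → activated (Cay Γ H) 1 S 2 ≡ ⊤
  Cay-covered-in-two-rounds {H} {S} {x} H²≡Γ x∈S = ⊆-antisym ⊆⊤ (λ {v} _ → reached v)
    where
    reached : ∀ v → v ∈ activated (Cay Γ H) 1 S 2
    reached v with H²≡Γ (v // x)
    ... | y , z , y∈H , z∈H , yz≡v/x =
      edge-activates (Cay Γ H) (edge-activates (Cay Γ H) x∈S (z , z∈H , refl)) (y , y∈H , sym v≡yzx)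
      where
      v≡yzx : y ∙ (z ∙ x) ≡ v
      v≡yzx = trans (sym (assoc y z x)) (trans (cong (_∙ x) yz≡v/x) (//-rightDividesˡ x v))

  Cay-d-s1≤2 : ∀ {H} s → 1 ≤ s → (∀ g → InSquare H g) → dstLe (Cay Γ H) s 1 2
  Cay-d-s1≤2 s 1≤s H²≡Γ S ∣S∣≡s with nonempty? S
  ... | yes (x , x∈S) = suc (suc zero) , Cay-covered-in-two-rounds H²≡Γ x∈S
  ... | no  S-empty   = contradiction ∣S∣≡0 (m<n⇒n≢0 (≤-trans 1≤s (≤-reflexive (sym ∣S∣≡s))))
    where
    ∣S∣≡0 : ∣ S ∣ ≡ 0
    ∣S∣≡0 = trans (cong ∣_∣ (Empty-unique S-empty)) (∣⊥∣≡0 n)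

  not-good⇒avoids : ∀ h s → 1 ≤ s → ∀ H →
    𝟙 (∣ H ∣ ≟ h) ≤ 𝟙 ((∣ H ∣ ≟ h) ×-dec dstLe? (Cay Γ H) s 1 2) + ∑[ g < n ] (𝟙 (∣ H ∣ ≟ h) * avoids g H)
  not-good⇒avoids h s 1≤s H = 𝟙≤𝟙-×-dec+ (∣ H ∣ ≟ h) (dstLe? (Cay Γ H) s 1 2) some-g-avoided
    where
    some-g-avoided : ∣ H ∣ ≡ h → ¬ dstLe (Cay Γ H) s 1 2 → 1 ≤ ∑[ g < n ] (𝟙 (∣ H ∣ ≟ h) * avoids g H)
    some-g-avoided ∣H∣≡h ¬d with ¬∀⟶∃¬ n (InSquare H) (inSquare? H) (λ H²≡Γ → ¬d (Cay-d-s1≤2 s 1≤s H²≡Γ))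
    ... | g , g∉H² = begin
      1                                       ≡⟨ cong₂ _*_ (𝟙-yes (∣ H ∣ ≟ h) ∣H∣≡h) (𝟙-yes (¬? (inSquare? H g)) g∉H²) ⟨
      𝟙 (∣ H ∣ ≟ h) * avoids g H              ≤⟨ f≤∑f (λ g → 𝟙 (∣ H ∣ ≟ h) * avoids g H) g ⟩
      ∑[ g < n ] (𝟙 (∣ H ∣ ≟ h) * avoids g H) ∎
      where open ≤-Reasoning

  numBad≤∑-avoiding : ∀ h s → 1 ≤ s →
    numSubsetsOfSize n h ∸ numGood Γ h s ≤ ∑[ g < n ] sizedSum n h (avoids g)
  numBad≤∑-avoiding h s 1≤s = m≤n+o⇒m∸n≤o (numSubsetsOfSize n h) (numGood Γ h s) (begin
    numSubsetsOfSize n h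
      ≡⟨ countSubsets≡∑ₛ𝟙 {n} (λ H → ∣ H ∣ ≟ h) ⟩
    ∑[ H ⊆ n ] (𝟙 (∣ H ∣ ≟ h))
      ≤⟨ sumᴸ-map-mono-≤ (not-good⇒avoids h s 1≤s) (allSubsets n) ⟩
    ∑[ H ⊆ n ] (𝟙 (good? H) + ∑[ g < n ] (𝟙 (∣ H ∣ ≟ h) * avoids g H))
      ≡⟨ sumᴸ-map-distrib-+ (𝟙 ∘ good?) (λ H → ∑[ g < n ] (𝟙 (∣ H ∣ ≟ h) * avoids g H)) (allSubsets n) ⟩
    ∑[ H ⊆ n ] (𝟙 (good? H)) + ∑[ H ⊆ n ] (∑[ g < n ] (𝟙 (∣ H ∣ ≟ h) * avoids g H))
      ≡⟨ cong₂ _+_ (sym (countSubsets≡∑ₛ𝟙 {n} good?)) (sumᴸ-map-∑-comm (λ H g → 𝟙 (∣ H ∣ ≟ h) * avoids g H) (allSubsets n)) ⟩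
    numGood Γ h s + ∑[ g < n ] sizedSum n h (avoids g) ∎)
    where
    open ≤-Reasoning
    good? : ∀ H → Dec (∣ H ∣ ≡ h × dstLe (Cay Γ H) s 1 2)
    good? H = (∣ H ∣ ≟ h) ×-dec dstLe? (Cay Γ H) s 1 2

numBad-bound : ∀ {n} (Γ : FinGroup n) h s k → 1 ≤ s → h ≤ n →
  suc k * n * falling₂ n h ≤ falling n h →
  suc k * (numSubsetsOfSize n h ∸ numGood Γ h s) ≤ numSubsetsOfSize n h
numBad-bound {n} Γ h s k 1≤s h≤n vanishes = *-cancelʳ-≤ (suc k * (A ∸ numGood Γ h s)) A Pₕ {{falling≢0 n h h≤n}} (begin
  suc k * (A ∸ numGood Γ h s) * Pₕ     ≤⟨ *-monoˡ-≤ Pₕ (*-monoʳ-≤ (suc k) (numBad≤∑-avoiding Γ h s 1≤s)) ⟩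
  suc k * (∑[ g < n ] B g) * Pₕ        ≡⟨ *-assoc (suc k) (∑[ g < n ] B g) Pₕ ⟩
  suc k * ((∑[ g < n ] B g) * Pₕ)      ≡⟨ cong (suc k *_) (*-distribʳ-sum Pₕ B) ⟩
  suc k * ∑[ g < n ] (B g * Pₕ)        ≤⟨ *-monoʳ-≤ (suc k) (∑-mono-≤ avoiding≤all) ⟩
  suc k * ∑[ _ < n ] (A * Qₕ)          ≡⟨ cong (suc k *_) (∑-const n (A * Qₕ)) ⟩
  suc k * (n * (A * Qₕ))               ≡⟨ solve 4 (λ k n a q → k :* (n :* (a :* q)) := a :* (k :* n :* q)) refl (suc k) n A Qₕ ⟩
  A * (suc k * n * Qₕ)                 ≤⟨ *-monoʳ-≤ A vanishes ⟩
  A * Pₕ                               ∎)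
  where
  open ≤-Reasoning
  A = numSubsetsOfSize n h
  B = λ g → sizedSum n h (avoids Γ g)
  Pₕ = falling n h
  Qₕ = falling₂ n h
  avoiding≤all : ∀ g → B g * Pₕ ≤ A * Qₕ
  avoiding≤all g = recurrence-comparison (numSubsetsOfSize n) (λ j → sizedSum n j (avoids Γ g)) (n ∸_) (λ i → n ∸ (i + i))
    (numSubsetsOfSize-suc n) (sizedSum-avoids-suc Γ g)
    (sizedSum-≤-numSubsetsOfSize n 0 (avoids Γ g) (λ H → 𝟙≤1 (¬? (inSquare? Γ H g)))) h

theorem3 : (a b : ℕ) → 0 < a → a < b →
    (s : ℕ) → 1 ≤ s →
    (Γ : (m : ℕ) → FinGroup (suc m)) → (h : ℕ → ℕ) →
    (∀ m → h m ≤ suc m) → (∀ m → a * suc m ≤ b * h m) →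
    ∀ (k : ℕ) → ∃ λ (N : ℕ) → ∀ m → N ≤ m →
      suc k * (numSubsetsOfSize (suc m) (h m) ∸ numGood (Γ m) (h m) s)
        ≤ numSubsetsOfSize (suc m) (h m)
theorem3 a b 0<a _ s 1≤s Γ h h≤n an≤bh k =
  let N , vanishes = falling₂/falling-vanishes b k in
  N , λ m N≤m →
  numBad-bound (Γ m) (h m) s k 1≤s (h≤n m)
    (vanishes (suc m) (h m) (≤-trans N≤m (n≤1+n m)) (≤-trans (m≤n*m (suc m) a {{>-nonZero 0<a}}) (an≤bh m)))
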